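{- Let $G$ be a finite simple graph with at least one edge that contains no induced $P_5$ and no induced $K_1\cup K_3$. Then $\chi(G)\le 3\omega(G)-3$.
   Context: $P_5$ is the path on 5 vertices; $K_1\cup K_3$ is the disjoint union of a single vertex and a triangle. $\chi$ is the chromatic number, $\omega$ the clique number. -}

module Defs where

open import Data.Nat using (ℕ; _≤_; _*_; _∸_)
open import Data.Fin using (Fin; zero; suc)
open import Data.Bool using (Bool; true; false)
open import Data.Product using (Σ; ∃; ∃-syntax; _×_; _,_)
open import Relation.Binary.PropositionalEquality using (_≡_; _≢_)
open import Relation.Nullary using (¬_)
open import Function.Definitions using (Injective)

record Graph (n : ℕ) : Set where
  field
    adj   : Fin n → Fin n → Bool
    sym   : ∀ i j → adj i j ≡ adj j i
    irrefl : ∀ i → adj i i ≡ false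
open Graph public

Adj : ∀ {n} → Graph n → Fin n → Fin n → Set
Adj G i j = adj G i j ≡ true

HasEdge : ∀ {n} → Graph n → Set
HasEdge G = ∃[ i ] ∃[ j ] Adj G i j

InducedSub : ∀ {k n} → Graph k → Graph n → Set
InducedSub {k} {n} H G =
  Σ (Fin k → Fin n) λ f → Injective _≡_ _≡_ f × (∀ i j → adj G (f i) (f j) ≡ adj H i j)

-- P5: path 0-1-2-3-4
p5adj : Fin 5 → Fin 5 → Bool
p5adj zero (suc zero) = true
p5adj (suc zero) zero = true
p5adj (suc zero) (suc (suc zero)) = true
p5adj (suc (suc zero)) (suc zero) = true
p5adj (suc (suc zero)) (suc (suc (suc zero))) = true
p5adj (suc (suc (suc zero))) (suc (suc zero)) = true
p5adj (suc (suc (suc zero))) (suc (suc (suc (suc zero)))) = true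
p5adj (suc (suc (suc (suc zero)))) (suc (suc (suc zero))) = true
p5adj _ _ = false

P5 : Graph 5
P5 = record { adj = p5adj ; sym = s ; irrefl = r }
  where
  s : ∀ i j → p5adj i j ≡ p5adj j i
  s zero zero = _≡_.refl
  s zero (suc zero) = _≡_.refl
  s zero (suc (suc zero)) = _≡_.refl
  s zero (suc (suc (suc zero))) = _≡_.refl
  s zero (suc (suc (suc (suc zero)))) = _≡_.refl
  s (suc zero) zero = _≡_.refl
  s (suc zero) (suc zero) = _≡_.refl
  s (suc zero) (suc (suc zero)) = _≡_.refl
  s (suc zero) (suc (suc (suc zero))) = _≡_.refl
  s (suc zero) (suc (suc (suc (suc zero)))) = _≡_.refl
  s (suc (suc zero)) zero = _≡_.refl
  s (suc (suc zero)) (suc zero) = _≡_.refl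
  s (suc (suc zero)) (suc (suc zero)) = _≡_.refl
  s (suc (suc zero)) (suc (suc (suc zero))) = _≡_.refl
  s (suc (suc zero)) (suc (suc (suc (suc zero)))) = _≡_.refl
  s (suc (suc (suc zero))) zero = _≡_.refl
  s (suc (suc (suc zero))) (suc zero) = _≡_.refl
  s (suc (suc (suc zero))) (suc (suc zero)) = _≡_.refl
  s (suc (suc (suc zero))) (suc (suc (suc zero))) = _≡_.refl
  s (suc (suc (suc zero))) (suc (suc (suc (suc zero)))) = _≡_.refl
  s (suc (suc (suc (suc zero)))) zero = _≡_.refl
  s (suc (suc (suc (suc zero)))) (suc zero) = _≡_.refl
  s (suc (suc (suc (suc zero)))) (suc (suc zero)) = _≡_.refl
  s (suc (suc (suc (suc zero)))) (suc (suc (suc zero))) = _≡_.refl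
  s (suc (suc (suc (suc zero)))) (suc (suc (suc (suc zero)))) = _≡_.refl
  r : ∀ i → p5adj i i ≡ false
  r zero = _≡_.refl
  r (suc zero) = _≡_.refl
  r (suc (suc zero)) = _≡_.refl
  r (suc (suc (suc zero))) = _≡_.refl
  r (suc (suc (suc (suc zero)))) = _≡_.refl

-- K1 ∪ K3: vertex 0 isolated, vertices 1,2,3 form a triangle
k1k3adj : Fin 4 → Fin 4 → Bool
k1k3adj zero _ = false
k1k3adj (suc _) zero = false
k1k3adj (suc zero) (suc zero) = false
k1k3adj (suc (suc zero)) (suc (suc zero)) = false
k1k3adj (suc (suc (suc zero))) (suc (suc (suc zero))) = false
k1k3adj (suc _) (suc _) = true

K1∪K3 : Graph 4
K1∪K3 = record { adj = k1k3adj ; sym = s ; irrefl = r }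
  where
  s : ∀ i j → k1k3adj i j ≡ k1k3adj j i
  s zero zero = _≡_.refl
  s zero (suc j) = _≡_.refl
  s (suc i) zero = _≡_.refl
  s (suc zero) (suc zero) = _≡_.refl
  s (suc zero) (suc (suc zero)) = _≡_.refl
  s (suc zero) (suc (suc (suc zero))) = _≡_.refl
  s (suc (suc zero)) (suc zero) = _≡_.refl
  s (suc (suc zero)) (suc (suc zero)) = _≡_.refl
  s (suc (suc zero)) (suc (suc (suc zero))) = _≡_.refl
  s (suc (suc (suc zero))) (suc zero) = _≡_.refl
  s (suc (suc (suc zero))) (suc (suc zero)) = _≡_.refl
  s (suc (suc (suc zero))) (suc (suc (suc zero))) = _≡_.refl
  r : ∀ i → k1k3adj i i ≡ false
  r zero = _≡_.refl
  r (suc zero) = _≡_.refl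
  r (suc (suc zero)) = _≡_.refl
  r (suc (suc (suc zero))) = _≡_.refl

HasClique : ∀ {n} → Graph n → ℕ → Set
HasClique {n} G k =
  Σ (Fin k → Fin n) λ f → Injective _≡_ _≡_ f × (∀ i j → i ≢ j → Adj G (f i) (f j))

IsCliqueNumber : ∀ {n} → Graph n → ℕ → Set
IsCliqueNumber G w = HasClique G w × (∀ k → HasClique G k → k ≤ w)

Colorable : ∀ {n} → Graph n → ℕ → Set
Colorable {n} G k = Σ (Fin n → Fin k) λ c → ∀ i j → Adj G i j → c i ≢ c j

IsChromaticNumber : ∀ {n} → Graph n → ℕ → Set
IsChromaticNumber G c = Colorable G c × (∀ k → Colorable G k → c ≤ k)

{-# OPTIONS --safe #-}
-- Induction on ω: the neighborhood of a vertex v has smaller clique number, while its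
-- non-neighborhood is triangle-free (a triangle there together with v is an induced K₁ ∪ K₃),
-- so each step costs at most 3 colors; the base case is Sumner's theorem that triangle-free
-- P₅-free graphs are 3-colorable. For that, in a P₅-free graph the vertices within distance 3
-- of u form the component of u. Color u with 0, the first and third distance layers with 1, and
-- a second-layer vertex with 2 or 0 according to whether it is adjacent to a fixed neighbor a
-- of u: the third layer is independent, and a is adjacent to exactly one end of each edge in the
-- second layer, since otherwise there is a triangle or an induced P₅.

module Submission where

open import Defs
open import Data.Bool using (true; false)
import Data.Bool.Properties as Bool
open import Data.Empty using (⊥; ⊥-elim)
open import Data.Fin using (Fin; zero; suc; join; splitAt)
open import Data.Fin.Patterns using (0F; 1F; 2F; 3F; 4F)
open import Data.Fin.Properties using (_≟_; all?; any?; splitAt-join)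
open import Data.Maybe using (Maybe; just; nothing)
import Data.Maybe as Maybe
open import Data.Nat using (ℕ; zero; suc; _+_; _≤_; _*_; _∸_; s≤s; z≤n)
open import Data.Nat.Properties using (≤-trans; ≤-reflexive; 1+n≰n; *-suc; *-comm; m+n∸m≡n)
open import Data.Product using (Σ; ∃-syntax; _×_; _,_; proj₁; proj₂)
open import Data.Sum using (_⊎_; inj₁; inj₂)
open import Data.Sum.Properties using (inj₁-injective; inj₂-injective)
open import Data.Unit using (tt)
open import Data.Vec using ([]; _∷_; lookup)
open import Function using (_∘_)
open import Function.Definitions using (Injective)
open import Level using (Level; 0ℓ)
open import Relation.Binary.PropositionalEquality as ≡ using (_≡_; _≢_; refl; trans; cong; subst; subst₂)
open import Relation.Nullary using (¬_; Dec; yes; no; ¬?; _×-dec_; _→-dec_)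
open import Relation.Nullary.Decidable using (from-yes)
open import Relation.Unary using (Pred; Decidable; _∈_; _∉_; _∩_; ∁; U; _≐_)
open import Relation.Unary.Properties using (_∩?_; ∁?; U?)

module _ {p : Level} where

  least : ∀ {m} {P : Pred (Fin m) p} → Decidable P → Maybe (Fin m)
  least {zero} P? = nothing
  least {suc m} P? with P? zero
  ... | yes _ = just zero
  ... | no _ = Maybe.map suc (least (P? ∘ suc))

  least-sound : ∀ {m} {P : Pred (Fin m) p} (P? : Decidable P) {i} → least P? ≡ just i → P i
  least-sound {suc m} P? e with P? zero
  least-sound {suc m} P? refl | yes P0 = P0
  ... | no _ with least (P? ∘ suc) in e′
  least-sound {suc m} P? refl | no _ | just j = least-sound (P? ∘ suc) e′

  least-nothing : ∀ {m} {P : Pred (Fin m) p} (P? : Decidable P) → least P? ≡ nothing → ∀ i → ¬ P i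
  least-nothing {suc m} P? e i Pi with P? zero
  least-nothing {suc m} P? () i Pi | yes _
  ... | no ¬P0 with least (P? ∘ suc) in e′
  least-nothing {suc m} P? refl zero Pi | no ¬P0 | nothing = ¬P0 Pi
  least-nothing {suc m} P? refl (suc i) Pi | no ¬P0 | nothing = least-nothing (P? ∘ suc) e′ i Pi

  least-cong : ∀ {m} {P Q : Pred (Fin m) p} (P? : Decidable P) (Q? : Decidable Q) → P ≐ Q → least P? ≡ least Q?
  least-cong {zero} P? Q? _ = refl
  least-cong {suc m} P? Q? (P⊆Q , Q⊆P) with P? zero | Q? zero
  ... | yes _ | yes _ = refl
  ... | yes P0 | no ¬Q0 = ⊥-elim (¬Q0 (P⊆Q P0))
  ... | no ¬P0 | yes Q0 = ⊥-elim (¬P0 (Q⊆P Q0))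
  ... | no _ | no _ = cong (Maybe.map suc) (least-cong (P? ∘ suc) (Q? ∘ suc) (P⊆Q , Q⊆P))

TwinFree : ∀ {k} → Graph k → Set
TwinFree {k} H = ∀ (i j : Fin k) → (∀ l → adj H i l ≡ adj H j l) → i ≡ j

twinFree? : ∀ {k} (H : Graph k) → Dec (TwinFree H)
twinFree? H = all? λ i → all? λ j → all? (λ l → adj H i l Bool.≟ adj H j l) →-dec i ≟ j

P5-twinFree : TwinFree P5
P5-twinFree = from-yes (twinFree? P5)

K1∪K3-twinFree : TwinFree K1∪K3
K1∪K3-twinFree = from-yes (twinFree? K1∪K3)

module _ {n : ℕ} (G : Graph n) where

  infix 4 _~_ _~?_

  _~_ : Fin n → Fin n → Set
  x ~ y = Adj G x y

  _~?_ : ∀ x y → Dec (x ~ y)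
  x ~? y = adj G x y Bool.≟ true

  adj-flip : ∀ {x y b} → adj G x y ≡ b → adj G y x ≡ b
  adj-flip {x} {y} = trans (Graph.sym G y x)

  ~-sym : ∀ {x y} → x ~ y → y ~ x
  ~-sym = adj-flip

  ~-irrefl : ∀ {x} → ¬ x ~ x
  ~-irrefl {x} x~x with () ← trans (≡.sym x~x) (irrefl G x)

  ≁⇒false : ∀ {x y} → ¬ x ~ y → adj G x y ≡ false
  ≁⇒false = Bool.¬-not

  induced-of-exact : ∀ {k} (H : Graph k) → TwinFree H → (f : Fin k → Fin n)
                   → (∀ i j → adj G (f i) (f j) ≡ adj H i j) → InducedSub H G
  induced-of-exact H twinFree f exact = f , injective , exact
    where
    injective : Injective _≡_ _≡_ f
    injective {i} {j} fi≡fj = twinFree i j λ l →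
      trans (≡.sym (exact i l)) (trans (cong (λ z → adj G z (f l)) fi≡fj) (exact j l))

  induced-P5 : ∀ {x₀ x₁ x₂ x₃ x₄} → x₀ ~ x₁ → x₁ ~ x₂ → x₂ ~ x₃ → x₃ ~ x₄
             → ¬ x₀ ~ x₂ → ¬ x₀ ~ x₃ → ¬ x₀ ~ x₄ → ¬ x₁ ~ x₃ → ¬ x₁ ~ x₄ → ¬ x₂ ~ x₄
             → InducedSub P5 G
  induced-P5 {x₀} {x₁} {x₂} {x₃} {x₄} e₀₁ e₁₂ e₂₃ e₃₄ n₀₂ n₀₃ n₀₄ n₁₃ n₁₄ n₂₄ =
    induced-of-exact P5 P5-twinFree f exact
    where
    f : Fin 5 → Fin n
    f = lookup (x₀ ∷ x₁ ∷ x₂ ∷ x₃ ∷ x₄ ∷ [])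
    exact : ∀ i j → adj G (f i) (f j) ≡ p5adj i j
    exact 0F 0F = irrefl G x₀
    exact 0F 1F = e₀₁
    exact 0F 2F = ≁⇒false n₀₂
    exact 0F 3F = ≁⇒false n₀₃
    exact 0F 4F = ≁⇒false n₀₄
    exact 1F 0F = adj-flip (exact 0F 1F)
    exact 1F 1F = irrefl G x₁
    exact 1F 2F = e₁₂
    exact 1F 3F = ≁⇒false n₁₃
    exact 1F 4F = ≁⇒false n₁₄
    exact 2F 0F = adj-flip (exact 0F 2F)
    exact 2F 1F = adj-flip (exact 1F 2F)
    exact 2F 2F = irrefl G x₂
    exact 2F 3F = e₂₃
    exact 2F 4F = ≁⇒false n₂₄
    exact 3F 0F = adj-flip (exact 0F 3F)
    exact 3F 1F = adj-flip (exact 1F 3F)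
    exact 3F 2F = adj-flip (exact 2F 3F)
    exact 3F 3F = irrefl G x₃
    exact 3F 4F = e₃₄
    exact 4F 0F = adj-flip (exact 0F 4F)
    exact 4F 1F = adj-flip (exact 1F 4F)
    exact 4F 2F = adj-flip (exact 2F 4F)
    exact 4F 3F = adj-flip (exact 3F 4F)
    exact 4F 4F = irrefl G x₄

  induced-K1∪K3 : ∀ {x₀ x₁ x₂ x₃} → ¬ x₀ ~ x₁ → ¬ x₀ ~ x₂ → ¬ x₀ ~ x₃
                → x₁ ~ x₂ → x₁ ~ x₃ → x₂ ~ x₃ → InducedSub K1∪K3 G
  induced-K1∪K3 {x₀} {x₁} {x₂} {x₃} n₀₁ n₀₂ n₀₃ e₁₂ e₁₃ e₂₃ =
    induced-of-exact K1∪K3 K1∪K3-twinFree f exact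
    where
    f : Fin 4 → Fin n
    f = lookup (x₀ ∷ x₁ ∷ x₂ ∷ x₃ ∷ [])
    exact : ∀ i j → adj G (f i) (f j) ≡ k1k3adj i j
    exact 0F 0F = irrefl G x₀
    exact 0F 1F = ≁⇒false n₀₁
    exact 0F 2F = ≁⇒false n₀₂
    exact 0F 3F = ≁⇒false n₀₃
    exact 1F 0F = adj-flip (exact 0F 1F)
    exact 1F 1F = irrefl G x₁
    exact 1F 2F = e₁₂
    exact 1F 3F = e₁₃
    exact 2F 0F = adj-flip (exact 0F 2F)
    exact 2F 1F = adj-flip (exact 1F 2F)
    exact 2F 2F = irrefl G x₂
    exact 2F 3F = e₂₃
    exact 3F 0F = adj-flip (exact 0F 3F)
    exact 3F 1F = adj-flip (exact 1F 3F)
    exact 3F 2F = adj-flip (exact 2F 3F)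
    exact 3F 3F = irrefl G x₃

  TriangleFreeOn : Pred (Fin n) 0ℓ → Set
  TriangleFreeOn S = ∀ {x y z} → x ∈ S → y ∈ S → z ∈ S → x ~ y → y ~ z → x ~ z → ⊥

  ColorableOn : Pred (Fin n) 0ℓ → ℕ → Set
  ColorableOn S k = Σ (Fin n → Fin k) λ c → ∀ {x y} → x ∈ S → y ∈ S → x ~ y → c x ≢ c y

  module BreadthFirstLayers (noP5 : ¬ InducedSub P5 G) {S : Pred (Fin n) 0ℓ} (S? : Decidable S) where

    -- The layers need not be disjoint (Layer₂ u u may hold): ball? tries them in order, and no
    -- argument below relies on disjointness.
    Layer₂ : Fin n → Fin n → Set
    Layer₂ u x = x ∈ S × ¬ u ~ x × ∃[ w ] (w ∈ S × u ~ w × w ~ x)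

    Layer₃ : Fin n → Fin n → Set
    Layer₃ u x = ¬ u ~ x × ¬ Layer₂ u x × ∃[ b ] (Layer₂ u b × b ~ x)

    data Ball (u x : Fin n) : Set where
      root   : x ≡ u → Ball u x
      near   : u ~ x → Ball u x
      second : Layer₂ u x → Ball u x
      third  : Layer₃ u x → Ball u x

    layer₂? : ∀ u x → Dec (Layer₂ u x)
    layer₂? u x = S? x ×-dec ¬? (u ~? x) ×-dec any? λ w → S? w ×-dec u ~? w ×-dec w ~? x

    layer₃? : ∀ u x → Dec (Layer₃ u x)
    layer₃? u x = ¬? (u ~? x) ×-dec ¬? (layer₂? u x) ×-dec any? λ b → layer₂? u b ×-dec b ~? x

    ball? : ∀ u x → Dec (Ball u x)
    ball? u x with x ≟ u | u ~? x | layer₂? u x | layer₃? u x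
    ... | yes x≡u | _ | _ | _ = yes (root x≡u)
    ... | no _ | yes u~x | _ | _ = yes (near u~x)
    ... | no _ | no _ | yes sx | _ = yes (second sx)
    ... | no _ | no _ | no _ | yes tx = yes (third tx)
    ... | no x≢u | no u≁x | no ¬sx | no ¬tx = no λ where
      (root x≡u) → x≢u x≡u
      (near u~x) → u≁x u~x
      (second sx) → ¬sx sx
      (third tx) → ¬tx tx

    ball-closed : ∀ {u x y} → x ∈ S → y ∈ S → Ball u y → y ~ x → Ball u x
    ball-closed {u} {x} {y} xS yS by y~x with ball? u x
    ... | yes bx = bx
    ... | no ¬bx = ⊥-elim (escape by)
      where
      u≁x : ¬ u ~ x
      u≁x = ¬bx ∘ near
      ¬sx : ¬ Layer₂ u x
      ¬sx = ¬bx ∘ second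
      escape : Ball u y → ⊥
      escape (root y≡u) = u≁x (subst (_~ x) y≡u y~x)
      escape (near u~y) = ¬sx (xS , u≁x , y , yS , u~y , y~x)
      escape (second sy) = ¬bx (third (u≁x , ¬sx , y , sy , y~x))
      escape (third (u≁y , ¬sy , b , sb@(_ , u≁b , w , wS , u~w , w~b) , b~y)) =
        noP5 (induced-P5 u~w w~b b~y y~x u≁b u≁y u≁x
                (λ w~y → ¬sy (yS , u≁y , w , wS , u~w , w~y))
                (λ w~x → ¬sx (xS , u≁x , w , wS , u~w , w~x))
                (λ b~x → ¬bx (third (u≁x , ¬sx , b , sb , b~x))))

    anchor : Fin n → Maybe (Fin n)
    anchor u = least λ w → S? w ×-dec u ~? w

    sideColor : Maybe (Fin n) → Fin n → Fin 3
    sideColor nothing _ = 0F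
    sideColor (just a) x with a ~? x
    ... | yes _ = 2F
    ... | no _ = 0F

    sideColor≢1F : ∀ m x → sideColor m x ≢ 1F
    sideColor≢1F nothing x ()
    sideColor≢1F (just a) x with a ~? x
    ... | yes _ = λ ()
    ... | no _ = λ ()

    layerColor : ∀ u x → Ball u x → Fin 3
    layerColor u x (root _) = 0F
    layerColor u x (near _) = 1F
    layerColor u x (second _) = sideColor (anchor u) x
    layerColor u x (third _) = 1F

    ballColor : ∀ u x → Dec (Ball u x) → Fin 3
    ballColor u x (yes bx) = layerColor u x bx
    ballColor u x (no _) = 0F

    -- Balls are components (ball-closed), so this picks one root per component.
    centre : Fin n → Maybe (Fin n)
    centre x = least λ u → S? u ×-dec ball? u x

    colorAt : Maybe (Fin n) → Fin n → Fin 3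
    colorAt (just u) x = ballColor u x (ball? u x)
    colorAt nothing x = 0F

    centre-cong : ∀ {x y} → x ∈ S → y ∈ S → x ~ y → centre x ≡ centre y
    centre-cong xS yS x~y = least-cong _ _
      ( (λ (uS , bx) → uS , ball-closed yS xS bx x~y)
      , (λ (uS , by) → uS , ball-closed xS yS by (~-sym x~y)))

    module _ (triangle-free : TriangleFreeOn S) where

      neighbor-separates : ∀ {u a x y} → u ∈ S → a ∈ S → u ~ a → Layer₂ u x → Layer₂ u y → x ~ y
                          → sideColor (just a) x ≢ sideColor (just a) y
      neighbor-separates {u} {a} {x} {y} uS aS u~a (xS , u≁x , w , wS , u~w , w~x) (yS , u≁y , _) x~y
        with a ~? x | a ~? y
      ... | yes a~x | yes a~y = λ _ → triangle-free aS xS yS a~x x~y a~y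
      ... | yes _ | no _ = λ ()
      ... | no _ | yes _ = λ ()
      ... | no a≁x | no a≁y = λ _ → noP5 (induced-P5 (~-sym u~a) u~w w~x x~y
                                    (λ a~w → triangle-free uS aS wS u~a a~w u~w) a≁x a≁y u≁x u≁y
                                    (λ w~y → triangle-free wS xS yS w~x x~y w~y))

      second-separated : ∀ {u x y} → u ∈ S → Layer₂ u x → Layer₂ u y → x ~ y
                       → sideColor (anchor u) x ≢ sideColor (anchor u) y
      second-separated {u} uS sx@(_ , _ , w , wS , u~w , _) sy x~y with anchor u in e
      ... | just a = let (aS , u~a) = least-sound _ e in neighbor-separates uS aS u~a sx sy x~y
      ... | nothing = ⊥-elim (least-nothing _ e w (wS , u~w))

      third-independent : ∀ {u x y} → x ∈ S → y ∈ S → Layer₃ u x → Layer₃ u y → ¬ x ~ y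
      third-independent {y = y} xS yS (u≁x , ¬sx , b , (bS , u≁b , w , wS , u~w , w~b) , b~x)
                                      (u≁y , ¬sy , _) x~y with b ~? y
      ... | yes b~y = triangle-free bS xS yS b~x x~y b~y
      ... | no b≁y = noP5 (induced-P5 u~w w~b b~x x~y u≁b u≁x u≁y
                       (λ w~x → ¬sx (xS , u≁x , w , wS , u~w , w~x))
                       (λ w~y → ¬sy (yS , u≁y , w , wS , u~w , w~y)) b≁y)

      layer-proper : ∀ {u x y} → u ∈ S → x ∈ S → y ∈ S → (bx : Ball u x) (by : Ball u y) → x ~ y
                   → layerColor u x bx ≢ layerColor u y by
      layer-proper _ _ _ (root x≡u) (root y≡u) x~y _ = ~-irrefl (subst₂ _~_ x≡u y≡u x~y)
      layer-proper _ _ _ (root _) (near _) _ ()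
      layer-proper {y = y} _ _ _ (root x≡u) (second (_ , u≁y , _)) x~y _ = u≁y (subst (_~ y) x≡u x~y)
      layer-proper _ _ _ (root _) (third _) _ ()
      layer-proper _ _ _ (near _) (root _) _ ()
      layer-proper uS xS yS (near u~x) (near u~y) x~y _ = triangle-free uS xS yS u~x x~y u~y
      layer-proper {u} {y = y} _ _ _ (near _) (second _) _ = sideColor≢1F (anchor u) y ∘ ≡.sym
      layer-proper {x = x} _ xS yS (near u~x) (third (u≁y , ¬sy , _)) x~y _ =
        ¬sy (yS , u≁y , x , xS , u~x , x~y)
      layer-proper {x = x} _ _ _ (second (_ , u≁x , _)) (root y≡u) x~y _ =
        u≁x (subst (_~ x) y≡u (~-sym x~y))
      layer-proper {u} {x} _ _ _ (second _) (near _) _ = sideColor≢1F (anchor u) x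
      layer-proper uS _ _ (second sx) (second sy) x~y = second-separated uS sx sy x~y
      layer-proper {u} {x} _ _ _ (second _) (third _) _ = sideColor≢1F (anchor u) x
      layer-proper _ _ _ (third _) (root _) _ ()
      layer-proper {y = y} _ xS yS (third (u≁x , ¬sx , _)) (near u~y) x~y _ =
        ¬sx (xS , u≁x , y , yS , u~y , ~-sym x~y)
      layer-proper {u} {y = y} _ _ _ (third _) (second _) _ = sideColor≢1F (anchor u) y ∘ ≡.sym
      layer-proper _ xS yS (third tx) (third ty) x~y _ = third-independent xS yS tx ty x~y

      ballColor-proper : ∀ {u x y} → u ∈ S → x ∈ S → y ∈ S → Ball u x → Ball u y → x ~ y
                        → ballColor u x (ball? u x) ≢ ballColor u y (ball? u y)
      ballColor-proper {u} {x} {y} uS xS yS bx by x~y with ball? u x | ball? u y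
      ... | yes bx′ | yes by′ = layer-proper uS xS yS bx′ by′ x~y
      ... | no ¬bx | _ = ⊥-elim (¬bx bx)
      ... | yes _ | no ¬by = ⊥-elim (¬by by)

      three-coloring : ColorableOn S 3
      three-coloring = (λ x → colorAt (centre x) x) , proper
        where
        proper : ∀ {x y} → x ∈ S → y ∈ S → x ~ y → colorAt (centre x) x ≢ colorAt (centre y) y
        proper {x} {y} xS yS x~y rewrite centre-cong xS yS x~y with centre y in e
        ... | just u = let (uS , by) = least-sound _ e
                       in ballColor-proper uS xS yS (ball-closed xS yS by (~-sym x~y)) by x~y
        ... | nothing = ⊥-elim (least-nothing _ e y (yS , root refl))

  triangle-free⇒3-colorable : ¬ InducedSub P5 G → ∀ {S} → Decidable S → TriangleFreeOn S → ColorableOn S 3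
  triangle-free⇒3-colorable noP5 S? = BreadthFirstLayers.three-coloring noP5 S?

  CliqueIn : Pred (Fin n) 0ℓ → ℕ → Set
  CliqueIn S k = Σ (Fin k → Fin n) λ f → (∀ i → f i ∈ S) × (∀ i j → i ≢ j → f i ~ f j)

  triangle-free-of-clique-free : ∀ {S} → ¬ CliqueIn S 3 → TriangleFreeOn S
  triangle-free-of-clique-free {S} noClique {x} {y} {z} xS yS zS x~y y~z x~z = noClique (f , f∈S , f~)
    where
    f : Fin 3 → Fin n
    f = lookup (x ∷ y ∷ z ∷ [])
    f∈S : ∀ i → f i ∈ S
    f∈S 0F = xS
    f∈S 1F = yS
    f∈S 2F = zS
    f~ : ∀ i j → i ≢ j → f i ~ f j
    f~ 0F 0F 0≢0 = ⊥-elim (0≢0 refl)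
    f~ 0F 1F _ = x~y
    f~ 0F 2F _ = x~z
    f~ 1F 0F _ = ~-sym x~y
    f~ 1F 1F 1≢1 = ⊥-elim (1≢1 refl)
    f~ 1F 2F _ = y~z
    f~ 2F 0F _ = ~-sym x~z
    f~ 2F 1F _ = ~-sym y~z
    f~ 2F 2F 2≢2 = ⊥-elim (2≢2 refl)

  neighborhood-clique-free : ∀ {S v k} → v ∈ S → ¬ CliqueIn S (suc k) → ¬ CliqueIn (S ∩ Adj G v) k
  neighborhood-clique-free {S} {v} {k} vS noClique (f , f∈N , f~) = noClique (g , g∈S , g~)
    where
    g : Fin (suc k) → Fin n
    g 0F = v
    g (suc i) = f i
    g∈S : ∀ i → g i ∈ S
    g∈S 0F = vS
    g∈S (suc i) = proj₁ (f∈N i)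
    g~ : ∀ i j → i ≢ j → g i ~ g j
    g~ 0F 0F 0≢0 = ⊥-elim (0≢0 refl)
    g~ 0F (suc j) _ = proj₂ (f∈N j)
    g~ (suc i) 0F _ = ~-sym (proj₂ (f∈N i))
    g~ (suc i) (suc j) i+1≢j+1 = f~ i j (i+1≢j+1 ∘ cong suc)

  non-neighbors-triangle-free : ¬ InducedSub K1∪K3 G → ∀ {S} v → TriangleFreeOn (S ∩ ∁ (Adj G v))
  non-neighbors-triangle-free noK1∪K3 v (_ , v≁x) (_ , v≁y) (_ , v≁z) x~y y~z x~z =
    noK1∪K3 (induced-K1∪K3 v≁x v≁y v≁z x~y x~z y~z)

  colorable-split : ∀ {S P k l} → Decidable P → ColorableOn (S ∩ ∁ P) k → ColorableOn (S ∩ P) l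
                  → ColorableOn S (k + l)
  colorable-split {S} {P} {k} {l} P? (c₁ , proper₁) (c₂ , proper₂) = c , proper
    where
    sideOf : ∀ x → Dec (P x) → Fin k ⊎ Fin l
    sideOf x (yes _) = inj₂ (c₂ x)
    sideOf x (no _) = inj₁ (c₁ x)
    side : Fin n → Fin k ⊎ Fin l
    side x = sideOf x (P? x)
    c : Fin n → Fin (k + l)
    c x = join k l (side x)
    side-proper : ∀ {x y} → x ∈ S → y ∈ S → x ~ y → side x ≢ side y
    side-proper {x} {y} xS yS x~y with P? x | P? y
    ... | yes Px | yes Py = proper₂ (xS , Px) (yS , Py) x~y ∘ inj₂-injective
    ... | no ¬Px | no ¬Py = proper₁ (xS , ¬Px) (yS , ¬Py) x~y ∘ inj₁-injective
    ... | yes _ | no _ = λ ()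
    ... | no _ | yes _ = λ ()
    proper : ∀ {x y} → x ∈ S → y ∈ S → x ~ y → c x ≢ c y
    proper {x} {y} xS yS x~y cx≡cy = side-proper xS yS x~y (begin
      side x                   ≡⟨ ≡.sym (splitAt-join k l (side x)) ⟩
      splitAt k (c x)          ≡⟨ cong (splitAt k) cx≡cy ⟩
      splitAt k (c y)          ≡⟨ splitAt-join k l (side y) ⟩
      side y                   ∎)
      where open ≡.≡-Reasoning

  empty-colorable : ∀ {S k} → (∀ x → x ∉ S) → ColorableOn S (suc k)
  empty-colorable S-empty = (λ _ → zero) , λ {x} xS → ⊥-elim (S-empty x xS)

  colorable-of-clique-free : ¬ InducedSub P5 G → ¬ InducedSub K1∪K3 G
                           → ∀ m {S} → Decidable S → ¬ CliqueIn S (3 + m) → ColorableOn S (suc m * 3)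
  colorable-of-clique-free noP5 noK1∪K3 zero S? noClique =
    triangle-free⇒3-colorable noP5 S? (triangle-free-of-clique-free noClique)
  colorable-of-clique-free noP5 noK1∪K3 (suc m) S? noClique with any? S?
  ... | no S-empty = empty-colorable λ x xS → S-empty (x , xS)
  ... | yes (v , vS) = colorable-split (v ~?_)
    (triangle-free⇒3-colorable noP5 (S? ∩? ∁? (v ~?_)) (non-neighbors-triangle-free noK1∪K3 v))
    (colorable-of-clique-free noP5 noK1∪K3 m (S? ∩? (v ~?_)) (neighborhood-clique-free vS noClique))

  clique-injective : ∀ {k} {f : Fin k → Fin n} → (∀ i j → i ≢ j → f i ~ f j) → Injective _≡_ _≡_ f
  clique-injective {f = f} f~ {i} {j} fi≡fj with i ≟ j
  ... | yes i≡j = i≡j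
  ... | no i≢j = ⊥-elim (~-irrefl (subst (f i ~_) (≡.sym fi≡fj) (f~ i j i≢j)))

  colorable-of-universe : ∀ {k} → ColorableOn U k → Colorable G k
  colorable-of-universe (c , proper) = c , λ _ _ → proper tt tt

  clique-number≥2 : HasEdge G → ∀ {w} → IsCliqueNumber G w → 2 ≤ w
  clique-number≥2 (x , y , x~y) (_ , ω-max) = ω-max 2 (f , clique-injective f~ , f~)
    where
    f : Fin 2 → Fin n
    f = lookup (x ∷ y ∷ [])
    f~ : ∀ i j → i ≢ j → f i ~ f j
    f~ 0F 0F 0≢0 = ⊥-elim (0≢0 refl)
    f~ 0F 1F _ = x~y
    f~ 1F 0F _ = ~-sym x~y
    f~ 1F 1F 1≢1 = ⊥-elim (1≢1 refl)

  chromatic≤[ω∸1]*3 : ¬ InducedSub P5 G → ¬ InducedSub K1∪K3 G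
             → ∀ m {c} → IsCliqueNumber G (2 + m) → IsChromaticNumber G c → c ≤ suc m * 3
  chromatic≤[ω∸1]*3 noP5 noK1∪K3 m (_ , ω-max) (_ , χ-min) =
    χ-min (suc m * 3) (colorable-of-universe (colorable-of-clique-free noP5 noK1∪K3 m U? noClique))
    where
    noClique : ¬ CliqueIn U (3 + m)
    noClique (f , _ , f~) = 1+n≰n (ω-max (3 + m) (f , clique-injective f~ , f~))

[1+m]*3≡3*[2+m]∸3 : ∀ m → suc m * 3 ≡ 3 * (2 + m) ∸ 3
[1+m]*3≡3*[2+m]∸3 m = begin
  suc m * 3             ≡⟨ *-comm (suc m) 3 ⟩
  3 * suc m             ≡⟨ ≡.sym (m+n∸m≡n 3 (3 * suc m)) ⟩
  3 + 3 * suc m ∸ 3     ≡⟨ cong (_∸ 3) (≡.sym (*-suc 3 (suc m))) ⟩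
  3 * (2 + m) ∸ 3       ∎
  where open ≡.≡-Reasoning

lemma6p2 : ∀ {n} (G : Graph n) → HasEdge G
    → ¬ InducedSub P5 G → ¬ InducedSub K1∪K3 G
    → ∀ (w c : ℕ) → IsCliqueNumber G w → IsChromaticNumber G c
    → c ≤ 3 * w ∸ 3
lemma6p2 G edge noP5 noK1∪K3 w c ω χ with clique-number≥2 G edge ω
... | s≤s (s≤s {n = m} z≤n) =
  ≤-trans (chromatic≤[ω∸1]*3 G noP5 noK1∪K3 m ω χ) (≤-reflexive ([1+m]*3≡3*[2+m]∸3 m))
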